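{- Let $x_1, x_2, x_3, \ldots$ be distinct Boolean variables, and for each integer $n \ge 2$ let $F_n$ be the CNF formula consisting of the single clause $\{x_1, x_2, \ldots, x_n\}$. On input $F_n$, Kumar's tree-construction algorithm (described in the context) performs at least $2^{n+1}-1$ steps. Consequently, there is no polynomial that upper bounds the running time of this algorithm as a function of input length. Moreover, none of the following proposed shortcut bounds applies to any $F_n$ with $n \ge 2$, where $F_n$ is over the variable set $V=\{x_1,\dots,x_n\}$ with $|V|=n$: (1) $\lVert F_n\rVert > 3^n-2^n$; (2) there is $x\in V$ with $\min(\#(F_n,x),\#(F_n,\overline{x})) > 3^{n-1}-2^{n-1}$; (3) there is $x\in V$ with $\#(F_n,x) \le 3^{n-1}-2^{n-1} < \#(F_n,\overline{x})$; (4) there is $x\in V$ with $\#(F_n,\overline{x}) \le 3^{n-1}-2^{n-1} < \#(F_n,x)$.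
   Context: CNF formulas are treated as sets of clauses, and clauses as sets of literals (and possibly the values true/false). A tautology clause is a clause containing the value true or containing both $x$ and $\overline{x}$ for some variable $x$. $\lVert F\rVert$ denotes the number of clauses of $F$, and $\#(F,\ell)$ denotes the number of clauses of $F$ containing the literal $\ell$. Kumar's algorithm maintains a tree $S$. The root is a special node with one child pointer; every other node is labeled by a variable and has two child pointers (left pointer representing the literal $\overline{x}$, right pointer representing $x$, for a node labeled $x$). A pointer not assigned a node has value "open" or "null"; newly created nodes have both pointers open. A path from the root downward (possibly ending in a pointer) represents the clause consisting of the literals labeling its pointers. The algorithm, on input CNF formula $F$: let $V$ be the variables of $F$; initialize $S$ as the root with its pointer open. For each clause $C\in F$: if $C=\emptyset$, reject; if $C$ is not a tautology clause, then (i) for each variable $v$ of $C$, if $S$ contains no node labeled $v$, then reject if $S$ has no open pointers, and otherwise attach a new node labeled $v$ to every open pointer; (ii) then, iterating over all pointers $p$ in $S$, if the clause represented by the path from the root to $p$ is a superset of $C$, set $p$ to null and delete all nodes below it. After all clauses are processed, reject if $S$ has no open pointer, else accept. Each node creation and each pointer inspection counts as at least one step; inputs are encoded in a standard way so that the length of $F_n$ is bounded by a polynomial in $n$. -}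

module Defs where

open import Data.Nat using (ℕ; zero; suc; _+_; _*_; _≡ᵇ_)
open import Data.Bool using (Bool; true; false; _∧_; _∨_; not; if_then_else_)
open import Data.List using (List; []; _∷_; applyUpTo)
open import Data.Product using (_×_; _,_)

-- Literals, clauses, CNF formulas.  Variables are natural numbers
-- (variable i stands for x_i).  Sets are represented by lists.

data Lit : Set where
  pos : ℕ → Lit
  neg : ℕ → Lit

data Elem : Set where
  lit  : Lit → Elem
  ⊤e   : Elem
  ⊥e   : Elem

Clause : Set
Clause = List Elem

CNF : Set
CNF = List Clause

_==L_ : Lit → Lit → Bool
pos i ==L pos j = i ≡ᵇ j
neg i ==L neg j = i ≡ᵇ j
pos _ ==L neg _ = false
neg _ ==L pos _ = false

memL : Lit → List Lit → Bool
memL ℓ []       = false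
memL ℓ (m ∷ ms) = (ℓ ==L m) ∨ memL ℓ ms

memC : Lit → Clause → Bool
memC ℓ []            = false
memC ℓ (lit m ∷ es)  = (ℓ ==L m) ∨ memC ℓ es
memC ℓ (⊤e ∷ es)     = memC ℓ es
memC ℓ (⊥e ∷ es)     = memC ℓ es

isTautAux : Clause → Clause → Bool
isTautAux C []                 = false
isTautAux C (⊤e ∷ es)          = true
isTautAux C (⊥e ∷ es)          = isTautAux C es
isTautAux C (lit (pos v) ∷ es) = memC (neg v) C ∨ isTautAux C es
isTautAux C (lit (neg v) ∷ es) = memC (pos v) C ∨ isTautAux C es

isTaut : Clause → Bool
isTaut C = isTautAux C C

isEmpty : Clause → Bool
isEmpty []      = true
isEmpty (_ ∷ _) = false

varsC : Clause → List ℕ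
varsC []                 = []
varsC (lit (pos v) ∷ es) = v ∷ varsC es
varsC (lit (neg v) ∷ es) = v ∷ varsC es
varsC (⊤e ∷ es)          = varsC es
varsC (⊥e ∷ es)          = varsC es

subsetOf : Clause → List Lit → Bool
subsetOf []            P = true
subsetOf (lit ℓ ∷ es)  P = memL ℓ P ∧ subsetOf es P
subsetOf (⊤e ∷ es)     P = false
subsetOf (⊥e ∷ es)     P = false

-- A value of type Ptr is the content of a pointer:
-- open, null, or a node labelled by a variable with a left pointer
-- (literal ¬x) and a right pointer (literal x).  The tree S is
-- represented by the content of the root's single pointer.

data Ptr : Set where
  openP  : Ptr
  null  : Ptr
  node  : ℕ → Ptr → Ptr → Ptr

hasLabel : ℕ → Ptr → Bool
hasLabel v openP        = false
hasLabel v null         = false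
hasLabel v (node u l r) = (v ≡ᵇ u) ∨ hasLabel v l ∨ hasLabel v r

hasOpen : Ptr → Bool
hasOpen openP        = true
hasOpen null         = false
hasOpen (node u l r) = hasOpen l ∨ hasOpen r

attach : ℕ → Ptr → Ptr × ℕ
attach v openP = node v openP openP , 1
attach v null = null , 0
attach v (node u l r) with attach v l | attach v r
... | l' , a | r' , b = node u l' r' , a + b

-- phase (ii): visit every pointer of S (pre-order), given the clause
-- represented by the path to the current pointer; each pointer
-- inspection counts one step.
prune : Clause → List Lit → Ptr → Ptr × ℕ
prune C P t with subsetOf C P
... | true  = null , 1
prune C P openP | false = openP , 1
prune C P null  | false = null , 1
prune C P (node v l r) | false with prune C (neg v ∷ P) l | prune C (pos v ∷ P) r
... | l' , a | r' , b = node v l' r' , suc (a + b)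

data Run : Set where
  rejected : Run
  running  : Ptr → Run

-- phase (i) for a list of variables; counts node creations as steps
phase1 : List ℕ → Ptr → Run × ℕ
phase1 []       t = running t , 0
phase1 (v ∷ vs) t =
  if hasLabel v t then phase1 vs t
  else (if not (hasOpen t) then (rejected , 0)
        else step (attach v t))
  where
  step : Ptr × ℕ → Run × ℕ
  step (t' , k) with phase1 vs t'
  ... | r , m = r , k + m

process : CNF → Ptr → Bool × ℕ
process []       t = hasOpen t , 0
process (C ∷ F) t =
  if isEmpty C then (false , 0)
  else (if isTaut C then process F t else go (phase1 (varsC C) t))
  where
  go : Run × ℕ → Bool × ℕ
  go (rejected , k) = false , k
  go (running t' , k) with prune C [] t'
  ... | t'' , m with process F t''
  ... | b , s = b , k + (m + s)

kumar : CNF → Bool × ℕ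
kumar F = process F openP

-- number of counted steps (node creations + pointer inspections in (ii))
kumarSteps : CNF → ℕ
kumarSteps F with kumar F
... | _ , s = s

Fn : ℕ → CNF
Fn n = applyUpTo (λ i → lit (pos (suc i))) n ∷ []

nClauses : CNF → ℕ
nClauses []      = 0
nClauses (_ ∷ F) = suc (nClauses F)

occ : CNF → Lit → ℕ
occ []      ℓ = 0
occ (C ∷ F) ℓ = if memC ℓ C then suc (occ F ℓ) else occ F ℓ

-- After phase (i) the tree for F_n is the complete binary tree whose level k
-- is labelled x_k (k = 1, …, n), with all 2^n leaf pointers open.  Only leaf
-- pointers can lie on a path containing x_n, so phase (ii) cuts nothing off
-- above the leaves and inspects all 2^(n+1) − 1 pointers.  The shortcut bounds
-- fail because F_n has a single clause and no negative literal.
module Submission where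

open import Defs
open import Data.Nat using (ℕ; zero; suc; _+_; _*_; _∸_; _^_; _≤_; _<_; _⊓_; _≡ᵇ_; z≤n; s≤s; NonZero)
open import Data.Nat.Properties
open import Data.Nat.Tactic.RingSolver using (solve-∀)
open import Data.Bool using (true; false; _∨_)
open import Data.Bool.Properties using (∧-zeroʳ)
open import Data.List using ([]; _∷_; applyUpTo)
open import Data.List.Membership.Propositional using (_∈_)
open import Data.List.Membership.Propositional.Properties using (∈-applyUpTo⁺)
open import Data.List.Relation.Unary.Any using (here; there)
open import Data.Product using (_×_; _,_; proj₂; Σ; ∃-syntax)
open import Function using (_∘_)
open import Relation.Binary.PropositionalEquality
open import Relation.Nullary using (¬_)

<⇒≡ᵇ-false : ∀ {m n} → m < n → (n ≡ᵇ m) ≡ false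
<⇒≡ᵇ-false {zero}  (s≤s _)   = refl
<⇒≡ᵇ-false {suc m} (s≤s m<n) = <⇒≡ᵇ-false m<n

complete : ℕ → ℕ → Ptr
complete s zero    = openP
complete s (suc m) = node s (complete (suc s) m) (complete (suc s) m)

hasLabel-complete : ∀ s m v → s + m ≤ v → hasLabel v (complete s m) ≡ false
hasLabel-complete s zero    v _ = refl
hasLabel-complete s (suc m) v s+1+m≤v
  = cong₂ (λ root child → root ∨ child ∨ child)
          (<⇒≡ᵇ-false (≤-trans (s≤s (m≤m+n s m)) sm≤v))
          (hasLabel-complete (suc s) m v sm≤v)
  where
  sm≤v : suc s + m ≤ v
  sm≤v = subst (_≤ v) (+-suc s m) s+1+m≤v

hasOpen-complete : ∀ s m → hasOpen (complete s m) ≡ true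
hasOpen-complete s zero    = refl
hasOpen-complete s (suc m) rewrite hasOpen-complete (suc s) m = refl

attach-complete : ∀ s m v → v ≡ s + m → attach v (complete s m) ≡ (complete s (suc m) , 2 ^ m)
attach-complete s zero    v refl rewrite +-identityʳ s = refl
attach-complete s (suc m) v v≡s+1+m
  rewrite attach-complete (suc s) m v (trans v≡s+1+m (+-suc s m))
        | +-identityʳ (2 ^ m) = refl

+-suc-shift : ∀ s m i → s + m + suc i ≡ s + suc m + i
+-suc-shift s m i = begin
  s + m + suc i     ≡⟨ +-suc (s + m) i ⟩
  suc (s + m) + i   ≡⟨ cong (_+ i) (sym (+-suc s m)) ⟩
  s + suc m + i     ∎
  where open ≡-Reasoning

phase1-complete : ∀ s m j (g : ℕ → ℕ) → (∀ i → g i ≡ s + m + i) →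
  ∃[ k ] phase1 (applyUpTo g j) (complete s m) ≡ (running (complete s (j + m)) , k)
phase1-complete s m zero    g g≗ = 0 , refl
phase1-complete s m (suc j) g g≗
  rewrite g≗ 0 | +-identityʳ (s + m)
        | hasLabel-complete s m (s + m) ≤-refl | hasOpen-complete s m
        | attach-complete s m (s + m) refl
  with phase1-complete s (suc m) j (g ∘ suc) (λ i → trans (g≗ (suc i)) (+-suc-shift s m i))
... | k , eq rewrite eq | +-suc j m = 2 ^ m + k , refl

posClause : (ℕ → ℕ) → ℕ → Clause
posClause g j = applyUpTo (λ i → lit (pos (g i))) j

varsC-posClause : ∀ g j → varsC (posClause g j) ≡ applyUpTo g j
varsC-posClause g zero    = refl
varsC-posClause g (suc j) = cong (g 0 ∷_) (varsC-posClause (g ∘ suc) j)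

memC-neg-posClause : ∀ g j v → memC (neg v) (posClause g j) ≡ false
memC-neg-posClause g zero    v = refl
memC-neg-posClause g (suc j) v = memC-neg-posClause (g ∘ suc) j v

isTautAux-posClause : ∀ D g j → (∀ v → memC (neg v) D ≡ false) → isTautAux D (posClause g j) ≡ false
isTautAux-posClause D g zero    _       = refl
isTautAux-posClause D g (suc j) noNeg rewrite noNeg (g 0) = isTautAux-posClause D (g ∘ suc) j noNeg

isTaut-posClause : ∀ g j → isTaut (posClause g j) ≡ false
isTaut-posClause g j = isTautAux-posClause (posClause g j) g j (memC-neg-posClause g j)

subsetOf-false : ∀ {ℓ C} P → lit ℓ ∈ C → memL ℓ P ≡ false → subsetOf C P ≡ false
subsetOf-false                 P (here refl)  ℓ∉P rewrite ℓ∉P = refl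
subsetOf-false {C = lit _ ∷ C} P (there ℓ∈C) ℓ∉P rewrite subsetOf-false P ℓ∈C ℓ∉P = ∧-zeroʳ _
subsetOf-false {C = ⊤e ∷ C}    P (there _)   _   = refl
subsetOf-false {C = ⊥e ∷ C}    P (there _)   _   = refl

steps-prune-open : ∀ C P → proj₂ (prune C P openP) ≡ 1
steps-prune-open C P with subsetOf C P
... | true  = refl
... | false = refl

steps-prune-node : ∀ C P v l r → subsetOf C P ≡ false →
  proj₂ (prune C P (node v l r)) ≡ suc (proj₂ (prune C (neg v ∷ P) l) + proj₂ (prune C (pos v ∷ P) r))
steps-prune-node C P v l r C⊈P rewrite C⊈P = refl

module _ {N : ℕ} {C : Clause} (xN∈C : lit (pos N) ∈ C) where

  steps-prune-complete : ∀ s m P → memL (pos N) P ≡ false → s + m ≤ suc N →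
    suc (proj₂ (prune C P (complete s m))) ≡ 2 ^ suc m
  steps-prune-complete s zero P _ _ rewrite steps-prune-open C P = refl
  steps-prune-complete s (suc zero) P xN∉P _
    rewrite subsetOf-false P xN∈C xN∉P
          | steps-prune-open C (neg s ∷ P) | steps-prune-open C (pos s ∷ P) = refl
  steps-prune-complete s (suc (suc m)) P xN∉P s+m+2≤N+1 = begin
    suc (proj₂ (prune C P (complete s (suc (suc m)))))
      ≡⟨ cong suc (steps-prune-node C P s _ _ (subsetOf-false P xN∈C xN∉P)) ⟩
    suc (suc (left + right))
      ≡⟨ cong suc (sym (+-suc left right)) ⟩
    suc left + suc right
      ≡⟨ cong₂ _+_ (steps-prune-complete (suc s) (suc m) (neg s ∷ P) xN∉P s+1+m+1≤N+1)
                   (steps-prune-complete (suc s) (suc m) (pos s ∷ P) xN∉xs∷P s+1+m+1≤N+1) ⟩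
    2 ^ suc (suc m) + 2 ^ suc (suc m)
      ≡⟨ cong (2 ^ suc (suc m) +_) (sym (+-identityʳ _)) ⟩
    2 ^ suc (suc (suc m)) ∎
    where
    open ≡-Reasoning
    left  = proj₂ (prune C (neg s ∷ P) (complete (suc s) (suc m)))
    right = proj₂ (prune C (pos s ∷ P) (complete (suc s) (suc m)))
    s+1+m+1≤N+1 : suc s + suc m ≤ suc N
    s+1+m+1≤N+1 = subst (_≤ suc N) (+-suc s (suc m)) s+m+2≤N+1
    s<N : s < N
    s<N = ≤-trans (m<m+n s (s≤s z≤n)) (≤-pred s+1+m+1≤N+1)
    xN∉xs∷P : memL (pos N) (pos s ∷ P) ≡ false
    xN∉xs∷P rewrite <⇒≡ᵇ-false s<N = xN∉P

steps-prune≤kumarSteps : ∀ C t k → isEmpty C ≡ false → isTaut C ≡ false →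
  phase1 (varsC C) openP ≡ (running t , k) → proj₂ (prune C [] t) ≤ kumarSteps (C ∷ [])
steps-prune≤kumarSteps C t k nonEmpty nonTaut phase1≡ rewrite nonEmpty | nonTaut | phase1≡ =
  ≤-trans (m≤m+n _ 0) (m≤n+m _ k)

kumarSteps-Fn : ∀ n → 1 ≤ n → 2 ^ (n + 1) ∸ 1 ≤ kumarSteps (Fn n)
kumarSteps-Fn n@(suc n-1) _ with phase1-complete 1 0 n suc (λ i → refl)
... | k , phase1≡ = begin
  2 ^ (n + 1) ∸ 1                                  ≡⟨ cong (λ e → 2 ^ e ∸ 1) (+-comm n 1) ⟩
  2 ^ suc n ∸ 1                                    ≡⟨ cong (_∸ 1) (sym all-pointers) ⟩
  proj₂ (prune (posClause suc n) [] (complete 1 n)) ≤⟨ steps-prune≤kumarSteps (posClause suc n) _ k refl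
                                                        (isTaut-posClause suc n) phase1≡′ ⟩
  kumarSteps (Fn n)                                ∎
  where
  open ≤-Reasoning
  phase1≡′ : phase1 (varsC (posClause suc n)) openP ≡ (running (complete 1 n) , k)
  phase1≡′ = trans (cong (λ vs → phase1 vs openP) (varsC-posClause suc n))
                   (trans phase1≡ (cong (λ m → running (complete 1 m) , k) (+-identityʳ n)))
  all-pointers : suc (proj₂ (prune (posClause suc n) [] (complete 1 n))) ≡ 2 ^ suc n
  all-pointers = steps-prune-complete (∈-applyUpTo⁺ (λ i → lit (pos (suc i))) (n<1+n n-1)) 1 n [] refl ≤-refl

n<2^n : ∀ n → n < 2 ^ n
n<2^n zero    = s≤s z≤n
n<2^n (suc n) = +-mono-≤ (m^n>0 2 n) (≤-trans (n<2^n n) (m≤m+n (2 ^ n) 0))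

2^n≤2^[n+1]∸1 : ∀ n → 2 ^ n ≤ 2 ^ (n + 1) ∸ 1
2^n≤2^[n+1]∸1 n = m+n≤o⇒m≤o∸n (2 ^ n) (begin
  2 ^ n + 1             ≤⟨ +-monoʳ-≤ (2 ^ n) (≤-trans (m^n>0 2 n) (m≤m+n (2 ^ n) 0)) ⟩
  2 ^ n + (2 ^ n + 0)   ≡⟨ cong (2 ^_) (+-comm 1 n) ⟩
  2 ^ (n + 1)           ∎)
  where open ≤-Reasoning

exp-beats-linear : ∀ A K → ∃[ t ] (1 ≤ t × A + t * K < 2 ^ t)
exp-beats-linear A K = s + s , s≤s z≤n , (begin-strict
  A + (s + s) * K           ≤⟨ +-monoˡ-≤ ((s + s) * K) (m≤n*m A s) ⟩
  s * A + (s + s) * K       <⟨ m<m+n _ (s≤s z≤n) ⟩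
  s * A + (s + s) * K + s   ≡⟨ square A K ⟩
  s * s                     <⟨ *-mono-< (n<2^n s) (n<2^n s) ⟩
  2 ^ s * 2 ^ s             ≡⟨ ^-distribˡ-+-* 2 s s ⟨
  2 ^ (s + s)               ∎)
  where
  open ≤-Reasoning
  s = suc (A + 2 * K)
  square : ∀ A K → let s = suc (A + 2 * K) in s * A + (s + s) * K + s ≡ s * s
  square = solve-∀

affine-≤-2^ : ∀ {c x} b e → c ≤ 2 ^ b → x ≤ 2 ^ e → c * x + c ≤ 2 ^ suc (b + e)
affine-≤-2^ {c} {x} b e c≤ x≤ = begin
  c * x + c                                ≤⟨ +-mono-≤ (*-mono-≤ c≤ x≤) (≤-trans c≤ (m≤m*n (2 ^ b) (2 ^ e) {{m^n≢0 2 e}})) ⟩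
  2 ^ b * 2 ^ e + 2 ^ b * 2 ^ e            ≡⟨ cong₂ _+_ (^-distribˡ-+-* 2 b e) (^-distribˡ-+-* 2 b e) ⟨
  2 ^ (b + e) + 2 ^ (b + e)                ≡⟨ cong (2 ^ (b + e) +_) (+-identityʳ _) ⟨
  2 ^ suc (b + e)                          ∎
  where open ≤-Reasoning

-- At n = 2^t a polynomial bound on len n is 2 to a power linear in t, which
-- 2^(2^t) eventually exceeds.
exponential-not-polynomially-bounded : (f : ℕ → ℕ) → (∀ n → 1 ≤ n → 2 ^ n ≤ f n) →
  (c k : ℕ) (len : ℕ → ℕ) → ((n : ℕ) → len n ≤ c * n ^ k + c) →
  (a d : ℕ) → ∃[ n ] (2 ≤ n × a * len n ^ d + a < f n)
exponential-not-polynomially-bounded f 2^n≤f c k len len≤poly a d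
  with exp-beats-linear (suc (a + suc c * d)) (k * d)
... | t , 1≤t , exponent<2^t = 2 ^ t , ^-monoʳ-≤ 2 1≤t , (begin-strict
  a * len (2 ^ t) ^ d + a                  ≤⟨ affine-≤-2^ a _ (<⇒≤ (n<2^n a)) len^d≤ ⟩
  2 ^ suc (a + suc (c + t * k) * d)        ≡⟨ cong (2 ^_) (exponent a c d k t) ⟩
  2 ^ (suc (a + suc c * d) + t * (k * d))  <⟨ ^-monoʳ-< 2 (s≤s (s≤s z≤n)) exponent<2^t ⟩
  2 ^ (2 ^ t)                              ≤⟨ 2^n≤f (2 ^ t) (m^n>0 2 t) ⟩
  f (2 ^ t)                                ∎)
  where
  open ≤-Reasoning
  exponent : ∀ a c d k t → suc (a + suc (c + t * k) * d) ≡ suc (a + suc c * d) + t * (k * d)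
  exponent = solve-∀
  len≤ : len (2 ^ t) ≤ 2 ^ suc (c + t * k)
  len≤ = ≤-trans (len≤poly (2 ^ t)) (affine-≤-2^ c (t * k) (<⇒≤ (n<2^n c)) (≤-reflexive (^-*-assoc 2 t k)))
  len^d≤ : len (2 ^ t) ^ d ≤ 2 ^ (suc (c + t * k) * d)
  len^d≤ = ≤-trans (^-monoˡ-≤ d len≤) (≤-reflexive (^-*-assoc 2 (suc (c + t * k)) d))

0<3^n∸2^n : ∀ n → .{{NonZero n}} → 0 < 3 ^ n ∸ 2 ^ n
0<3^n∸2^n n = m<n⇒0<n∸m (^-monoˡ-< n (n<1+n 2))

occ-Fn-neg : ∀ n i → occ (Fn n) (neg i) ≡ 0
occ-Fn-neg n i rewrite memC-neg-posClause suc n i = refl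

occ-Fn-pos≤1 : ∀ n i → occ (Fn n) (pos i) ≤ 1
occ-Fn-pos≤1 n i with memC (pos i) (posClause suc n)
... | true  = ≤-refl
... | false = z≤n

mainTheorem1 : ((n : ℕ) → 2 ≤ n → 2 ^ (n + 1) ∸ 1 ≤ kumarSteps (Fn n))
    × ((c k : ℕ) (len : ℕ → ℕ) → ((n : ℕ) → len n ≤ c * n ^ k + c) →
        (a d : ℕ) → ∃[ n ] (2 ≤ n × a * len n ^ d + a < kumarSteps (Fn n)))
    × ((n : ℕ) → 2 ≤ n →
        ¬ (3 ^ n ∸ 2 ^ n < nClauses (Fn n))
        × ¬ (Σ ℕ (λ i → 1 ≤ i × i ≤ n ×
               3 ^ (n ∸ 1) ∸ 2 ^ (n ∸ 1) < occ (Fn n) (pos i) ⊓ occ (Fn n) (neg i)))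
        × ¬ (Σ ℕ (λ i → 1 ≤ i × i ≤ n ×
               occ (Fn n) (pos i) ≤ 3 ^ (n ∸ 1) ∸ 2 ^ (n ∸ 1) ×
               3 ^ (n ∸ 1) ∸ 2 ^ (n ∸ 1) < occ (Fn n) (neg i)))
        × ¬ (Σ ℕ (λ i → 1 ≤ i × i ≤ n ×
               occ (Fn n) (neg i) ≤ 3 ^ (n ∸ 1) ∸ 2 ^ (n ∸ 1) ×
               3 ^ (n ∸ 1) ∸ 2 ^ (n ∸ 1) < occ (Fn n) (pos i))))
mainTheorem1 =
    (λ n 2≤n → kumarSteps-Fn n (<⇒≤ 2≤n))
  , exponential-not-polynomially-bounded (kumarSteps ∘ Fn)
      (λ n 1≤n → ≤-trans (2^n≤2^[n+1]∸1 n) (kumarSteps-Fn n 1≤n))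
  , λ { n (s≤s (s≤s z≤n)) →
          (λ gap<1 → <⇒≱ gap<1 (0<3^n∸2^n n))
        , (λ { (i , _ , _ , gap<min) →
                 n≮0 (subst (_ <_) (occ-Fn-neg n i) (≤-trans gap<min (m⊓n≤n _ _))) })
        , (λ { (i , _ , _ , _ , gap<occ) → n≮0 (subst (_ <_) (occ-Fn-neg n i) gap<occ) })
        , (λ { (i , _ , _ , _ , gap<occ) →
                 <⇒≱ (≤-trans gap<occ (occ-Fn-pos≤1 n i)) (0<3^n∸2^n (n ∸ 1)) }) }
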